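{- For all integers $n\geq m\geq 1$, \[ \chi_d^t(C(K_{m,n}))=\begin{cases}4 & \text{if } (m,n)=(1,2),\\ m+n & \text{otherwise},\end{cases} \] where $K_{m,n}$ is the complete bipartite graph with parts of sizes $m$ and $n$.
   Context: For a graph $G=(V,E)$ with $V=\{v_1,\dots,v_n\}$, the central graph $C(G)$ is the graph with vertex set $V\cup\{c_{ij} : v_iv_j\in E\}$ obtained by subdividing each edge $v_iv_j$ of $G$ exactly once by a new vertex $c_{ij}$ (adjacent to exactly $v_i$ and $v_j$) and joining every pair of distinct vertices non-adjacent in $G$. A total dominator coloring (TDC) of a graph $H$ with no isolated vertices is a proper vertex coloring of $H$ in which every vertex is adjacent to all vertices of some color class. $\chi_d^t(H)$ is the minimum number of color classes in a TDC of $H$. -}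

module Defs where

open import Data.Nat using (ℕ; _+_; _≤_)
open import Data.Fin using (Fin; splitAt; _<_)
open import Data.Sum using (_⊎_; inj₁; inj₂)
open import Data.Product using (Σ; _×_; _,_; ∃; ∃-syntax; proj₁; proj₂)
open import Data.Empty using (⊥)
open import Data.Unit using (⊤)
open import Relation.Nullary using (¬_)
open import Relation.Binary.PropositionalEquality using (_≡_; _≢_)

record Graph (V : Set) : Set₁ where
  field
    Adj   : V → V → Set
    sym   : ∀ {x y} → Adj x y → Adj y x
    irrefl : ∀ {x} → ¬ Adj x x
open Graph public

bipAdj : (m n : ℕ) → Fin (m + n) → Fin (m + n) → Set
bipAdj m n x y with splitAt m x | splitAt m y
... | inj₁ _ | inj₂ _ = ⊤
... | inj₂ _ | inj₁ _ = ⊤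
... | _      | _      = ⊥

K : (m n : ℕ) → Graph (Fin (m + n))
K m n = record { Adj = bipAdj m n ; sym = s ; irrefl = ir }
  where
  s : ∀ {x y} → bipAdj m n x y → bipAdj m n y x
  s {x} {y} p with splitAt m x | splitAt m y
  ... | inj₁ _ | inj₂ _ = _
  ... | inj₂ _ | inj₁ _ = _
  ir : ∀ {x} → ¬ bipAdj m n x x
  ir {x} p with splitAt m x
  ... | inj₁ _ = p
  ... | inj₂ _ = p

Edge : ∀ {N} → Graph (Fin N) → Set
Edge {N} G = Σ (Fin N) λ i → Σ (Fin N) λ j → (i < j) × Adj G i j

-- Vertices of the central graph: original vertices plus one subdivision
-- vertex c_ij per edge.
CV : ∀ {N} → Graph (Fin N) → Set
CV {N} G = Fin N ⊎ Edge G

CAdj : ∀ {N} (G : Graph (Fin N)) → CV G → CV G → Set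
CAdj G (inj₁ x) (inj₁ y) = (x ≢ y) × ¬ Adj G x y
CAdj G (inj₁ x) (inj₂ (i , j , _)) = (x ≡ i) ⊎ (x ≡ j)
CAdj G (inj₂ (i , j , _)) (inj₁ x) = (x ≡ i) ⊎ (x ≡ j)
CAdj G (inj₂ _) (inj₂ _) = ⊥

central : ∀ {N} (G : Graph (Fin N)) → Graph (CV G)
central G = record { Adj = CAdj G ; sym = s ; irrefl = ir }
  where
  s : ∀ {x y} → CAdj G x y → CAdj G y x
  s {inj₁ x} {inj₁ y} (x≢y , na) = (λ e → x≢y (Relation.Binary.PropositionalEquality.sym e)) , λ a → na (Graph.sym G a)
  s {inj₁ x} {inj₂ _} p = p
  s {inj₂ _} {inj₁ x} p = p
  s {inj₂ _} {inj₂ _} ()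
  ir : ∀ {x} → ¬ CAdj G x x
  ir {inj₁ x} (x≢x , _) = x≢x Relation.Binary.PropositionalEquality.refl
  ir {inj₂ _} ()

record IsTDC {V : Set} (H : Graph V) (k : ℕ) (c : V → Fin k) : Set where
  field
    proper    : ∀ {x y} → Adj H x y → c x ≢ c y
    onto      : ∀ (a : Fin k) → ∃[ v ] c v ≡ a
    dominates : ∀ (v : V) → ∃[ a ] (∀ (u : V) → c u ≡ a → Adj H v u)

HasTDC : {V : Set} → Graph V → ℕ → Set
HasTDC {V} H k = ∃[ c ] IsTDC H k c

TDCNumber : {V : Set} → Graph V → ℕ → Set
TDCNumber H k = HasTDC H k × (∀ j → HasTDC H j → k ≤ j)

-- In C(K_{m,n}) each part of K_{m,n} becomes a clique, there are no edges between the two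
-- parts, and the vertex subdividing the edge ab is adjacent to a and b only, so in a TDC it
-- dominates the colour class of a or that of b. Colours within a part are distinct, and this
-- domination allows at most one colour to be shared by the two parts; when a and b share a
-- colour, the vertex subdividing ab has a colour used by no original vertex. Either way at
-- least m + n colours occur. For K_{1,2} a fourth colour is forced: without a shared colour it
-- is the class dominated by the vertex of the small part; with a shared colour at ab, the other
-- vertex b' of the large part can only dominate the class of the vertex subdividing ab', which
-- therefore differs in colour from the one subdividing ab.
-- The bounds are attained: for m, n ≥ 2 colour the original vertices injectively and the vertex
-- subdividing ab like the cyclic predecessor of a; for m = 1 and n ≠ 2 let the vertex of the
-- small part share its colour with one vertex of the large part and give all subdivision
-- vertices a single further colour.

module Submission where

open import Defs hiding (sym)
open import Data.Nat using (ℕ; suc; _+_; _≤_; s≤s)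
open import Data.Nat.Properties using (<-≤-trans; m≤m+n)
open import Data.Fin as Fin using (Fin; zero; suc; toℕ; _↑ˡ_; _↑ʳ_; splitAt; join; fromℕ; inject₁; _≟_)
open import Data.Fin.Properties
  using (suc-injective; toℕ<n; toℕ-↑ˡ; toℕ-↑ʳ; ↑ˡ-injective; ↑ʳ-injective; splitAt-↑ˡ; splitAt-↑ʳ;
         splitAt⁻¹-↑ˡ; splitAt⁻¹-↑ʳ; join-splitAt; <-irrelevant; <-asym; fromℕ≢inject₁;
         inject₁-injective; injective⇒≤; any?)
open import Data.Vec.Functional using ([]; _∷_)
open import Data.Sum using (_⊎_; inj₁; inj₂; [_,_])
open import Data.Product using (_×_; _,_; ∃-syntax; ∃₂; proj₁; proj₂; uncurry)
open import Data.Empty using (⊥; ⊥-elim)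
open import Data.Unit using (tt)
open import Function using (_∘_)
open import Function.Definitions using (Injective)
open import Relation.Binary.Definitions using (DecidableEquality)
open import Relation.Nullary using (¬_; yes; no)
open import Relation.Binary.PropositionalEquality
  using (_≡_; _≢_; refl; sym; trans; cong; cong₂; subst₂; module ≡-Reasoning)

[,]-injective : ∀ {A B C : Set} {f : A → C} {g : B → C} →
  Injective _≡_ _≡_ f → Injective _≡_ _≡_ g → (∀ a b → f a ≢ g b) →
  Injective _≡_ _≡_ [ f , g ]
[,]-injective f-inj g-inj f≢g {inj₁ a} {inj₁ a'} eq = cong inj₁ (f-inj eq)
[,]-injective f-inj g-inj f≢g {inj₁ a} {inj₂ b} eq = ⊥-elim (f≢g a b eq)
[,]-injective f-inj g-inj f≢g {inj₂ b} {inj₁ a} eq = ⊥-elim (f≢g a b (sym eq))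
[,]-injective f-inj g-inj f≢g {inj₂ b} {inj₂ b'} eq = cong inj₂ (g-inj eq)

⊎-injective⇒+≤ : ∀ {m n k} {f : Fin m ⊎ Fin n → Fin k} → Injective _≡_ _≡_ f → m + n ≤ k
⊎-injective⇒+≤ {m} {n} f-inj = injective⇒≤ λ {i} {j} eq → begin
    i                          ≡⟨ join-splitAt m n i ⟨
    join m n (splitAt m i)     ≡⟨ cong (join m n) (f-inj {splitAt m i} {splitAt m j} eq) ⟩
    join m n (splitAt m j)     ≡⟨ join-splitAt m n j ⟩
    j                          ∎
  where open ≡-Reasoning

pair-injective : ∀ {k} {x y : Fin k} → x ≢ y → Injective _≡_ _≡_ (x ∷ y ∷ [])
pair-injective x≢y {zero}     {zero}     _  = refl
pair-injective x≢y {zero}     {suc zero} eq = ⊥-elim (x≢y eq)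
pair-injective x≢y {suc zero} {zero}     eq = ⊥-elim (x≢y (sym eq))
pair-injective x≢y {suc zero} {suc zero} _  = refl

four-distinct⇒4≤ : ∀ {k} {w x y z : Fin k} →
  w ≢ x → w ≢ y → w ≢ z → x ≢ y → x ≢ z → y ≢ z → 4 ≤ k
four-distinct⇒4≤ {w = w} {x} {y} {z} w≢x w≢y w≢z x≢y x≢z y≢z =
  ⊎-injective⇒+≤ {2} {2} ([,]-injective (pair-injective w≢x) (pair-injective y≢z) disjoint)
  where
  disjoint : ∀ i j → (w ∷ x ∷ []) i ≢ (y ∷ z ∷ []) j
  disjoint zero       zero       = w≢y
  disjoint zero       (suc zero) = w≢z
  disjoint (suc zero) zero       = x≢y
  disjoint (suc zero) (suc zero) = x≢z

rotateDown : ∀ {k} → Fin (suc (suc k)) → Fin (suc (suc k))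
rotateDown {k} zero = fromℕ (suc k)
rotateDown (suc i) = inject₁ i

rotateDown-injective : ∀ {k} → Injective _≡_ _≡_ (rotateDown {k})
rotateDown-injective {x = zero}  {zero}  _  = refl
rotateDown-injective {x = zero}  {suc j} eq = ⊥-elim (fromℕ≢inject₁ eq)
rotateDown-injective {x = suc i} {zero}  eq = ⊥-elim (fromℕ≢inject₁ (sym eq))
rotateDown-injective {x = suc i} {suc j} eq = cong suc (inject₁-injective eq)

inject₁≢suc : ∀ {k} (i : Fin k) → inject₁ i ≢ suc i
inject₁≢suc zero    ()
inject₁≢suc (suc i) eq = inject₁≢suc i (suc-injective eq)

rotateDown≢id : ∀ {k} (i : Fin (suc (suc k))) → rotateDown i ≢ i
rotateDown≢id zero    ()
rotateDown≢id (suc i) = inject₁≢suc i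

module _ {V : Set} (H : Graph V) {k : ℕ} (col : V → Fin k) where

  Dominates : V → Fin k → Set
  Dominates v t = ∀ u → col u ≡ t → Adj H v u

  dominates-neighbour-class : IsTDC H k col → ∀ v → ∃[ u ] Adj H v u × Dominates v (col u)
  dominates-neighbour-class tdc v with IsTDC.dominates tdc v
  ... | t , D with IsTDC.onto tdc t
  ... | u , refl = u , D u refl , D

  proper-injective-on-clique : ∀ {A : Set} → DecidableEquality A → (clique : A → V) →
    (∀ {a a'} → a ≢ a' → Adj H (clique a) (clique a')) →
    (∀ {x y} → Adj H x y → col x ≢ col y) → Injective _≡_ _≡_ (col ∘ clique)
  proper-injective-on-clique _≟ᴬ_ clique adj proper {a} {a'} eq with a ≟ᴬ a'
  ... | yes a≡a' = a≡a'
  ... | no  a≢a' = ⊥-elim (proper (adj a≢a') eq)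

module CentralCompleteBipartite (m n : ℕ) where

  H : Graph (CV (K m n))
  H = central (K m n)

  Vertex : Set
  Vertex = CV (K m n)

  ↑ˡ≢↑ʳ : ∀ (a : Fin m) (b : Fin n) → a ↑ˡ n ≢ m ↑ʳ b
  ↑ˡ≢↑ʳ a b eq with trans (sym (splitAt-↑ˡ m a n)) (trans (cong (splitAt m) eq) (splitAt-↑ʳ m n b))
  ... | ()

  ↑ˡ<↑ʳ : ∀ (a : Fin m) (b : Fin n) → a ↑ˡ n Fin.< m ↑ʳ b
  ↑ˡ<↑ʳ a b rewrite toℕ-↑ˡ a n | toℕ-↑ʳ m b = <-≤-trans (toℕ<n a) (m≤m+n m (toℕ b))

  bipAdj-irrelevant : ∀ x y (p q : bipAdj m n x y) → p ≡ q
  bipAdj-irrelevant x y p q with splitAt m x | splitAt m y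
  ... | inj₁ _ | inj₂ _ = refl
  ... | inj₂ _ | inj₁ _ = refl
  ... | inj₁ _ | inj₁ _ = ⊥-elim p
  ... | inj₂ _ | inj₂ _ = ⊥-elim p

  bipAdj-↑ˡ-↑ʳ : ∀ (a : Fin m) (b : Fin n) → bipAdj m n (a ↑ˡ n) (m ↑ʳ b)
  bipAdj-↑ˡ-↑ʳ a b rewrite splitAt-↑ˡ m a n | splitAt-↑ʳ m n b = tt

  ¬bipAdj-↑ˡ-↑ˡ : ∀ (a a' : Fin m) → ¬ bipAdj m n (a ↑ˡ n) (a' ↑ˡ n)
  ¬bipAdj-↑ˡ-↑ˡ a a' rewrite splitAt-↑ˡ m a n | splitAt-↑ˡ m a' n = λ ()

  ¬bipAdj-↑ʳ-↑ʳ : ∀ (b b' : Fin n) → ¬ bipAdj m n (m ↑ʳ b) (m ↑ʳ b')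
  ¬bipAdj-↑ʳ-↑ʳ b b' rewrite splitAt-↑ʳ m n b | splitAt-↑ʳ m n b' = λ ()

  edge : Fin m → Fin n → Edge (K m n)
  edge a b = a ↑ˡ n , m ↑ʳ b , ↑ˡ<↑ʳ a b , bipAdj-↑ˡ-↑ʳ a b

  edge-injective : ∀ {a a' b b'} → edge a b ≡ edge a' b' → a ≡ a' × b ≡ b'
  edge-injective eq = ↑ˡ-injective n _ _ (cong proj₁ eq) , ↑ʳ-injective m _ _ (cong (proj₁ ∘ proj₂) eq)

  edge-endpoints : ∀ {i j} → i Fin.< j → bipAdj m n i j → ∃₂ λ a b → a ↑ˡ n ≡ i × m ↑ʳ b ≡ j
  edge-endpoints {i} {j} i<j ij with splitAt m i in eqᵢ | splitAt m j in eqⱼ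
  ... | inj₁ a | inj₂ b = a , b , splitAt⁻¹-↑ˡ eqᵢ , splitAt⁻¹-↑ʳ eqⱼ
  ... | inj₁ _ | inj₁ _ = ⊥-elim ij
  ... | inj₂ _ | inj₂ _ = ⊥-elim ij
  ... | inj₂ a | inj₁ b =
    ⊥-elim (<-asym i<j (subst₂ Fin._<_ (splitAt⁻¹-↑ˡ eqⱼ) (splitAt⁻¹-↑ʳ eqᵢ) (↑ˡ<↑ʳ b a)))

  edge-surjective : ∀ e → ∃₂ λ a b → edge a b ≡ e
  edge-surjective (i , j , i<j , ij) with edge-endpoints i<j ij
  ... | a , b , refl , refl = a , b , cong₂ (λ p q → a ↑ˡ n , m ↑ʳ b , p , q) (<-irrelevant _ _) (bipAdj-irrelevant _ _ _ _)

  endpoints : Edge (K m n) → Fin m × Fin n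
  endpoints e = proj₁ (edge-surjective e) , proj₁ (proj₂ (edge-surjective e))

  endpoints-edge : ∀ a b → endpoints (edge a b) ≡ (a , b)
  endpoints-edge a b with edge-injective (proj₂ (proj₂ (edge-surjective (edge a b))))
  ... | a'≡a , b'≡b = cong₂ _,_ a'≡a b'≡b

  left : Fin m → Vertex
  left a = inj₁ (a ↑ˡ n)

  right : Fin n → Vertex
  right b = inj₁ (m ↑ʳ b)

  sub : Fin m → Fin n → Vertex
  sub a b = inj₂ (edge a b)

  data VertexView : Vertex → Set where
    is-left  : ∀ a → VertexView (left a)
    is-right : ∀ b → VertexView (right b)
    is-sub   : ∀ a b → VertexView (sub a b)

  vertexView : ∀ u → VertexView u
  vertexView (inj₁ x) with splitAt m x in eq
  ... | inj₁ a rewrite sym (splitAt⁻¹-↑ˡ eq) = is-left a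
  ... | inj₂ b rewrite sym (splitAt⁻¹-↑ʳ eq) = is-right b
  vertexView (inj₂ e) with edge-surjective e
  ... | a , b , refl = is-sub a b

  left-adj : ∀ {a a'} → a ≢ a' → Adj H (left a) (left a')
  left-adj {a} {a'} a≢a' = (λ eq → a≢a' (↑ˡ-injective n a a' eq)) , ¬bipAdj-↑ˡ-↑ˡ a a'

  right-adj : ∀ {b b'} → b ≢ b' → Adj H (right b) (right b')
  right-adj {b} {b'} b≢b' = (λ eq → b≢b' (↑ʳ-injective m b b' eq)) , ¬bipAdj-↑ʳ-↑ʳ b b'

  left-right-nonadj : ∀ a b → ¬ Adj H (left a) (right b)
  left-right-nonadj a b (_ , ¬ab) = ¬ab (bipAdj-↑ˡ-↑ʳ a b)

  right-left-nonadj : ∀ b a → ¬ Adj H (right b) (left a)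
  right-left-nonadj b a = left-right-nonadj a b ∘ Graph.sym H {right b} {left a}

  left-adj-sub : ∀ {a a'} b → a ≡ a' → Adj H (left a) (sub a' b)
  left-adj-sub _ a≡a' = inj₁ (cong (_↑ˡ n) a≡a')

  right-adj-sub : ∀ {b b'} a → b ≡ b' → Adj H (right b) (sub a b')
  right-adj-sub _ b≡b' = inj₂ (cong (m ↑ʳ_) b≡b')

  sub-adj-left : ∀ {a a'} b → a' ≡ a → Adj H (sub a b) (left a')
  sub-adj-left {a} {a'} b = Graph.sym H {left a'} {sub a b} ∘ left-adj-sub b

  sub-adj-right : ∀ {b b'} a → b' ≡ b → Adj H (sub a b) (right b')
  sub-adj-right {b} {b'} a = Graph.sym H {right b'} {sub a b} ∘ right-adj-sub a

  sub-neighbour : ∀ {a b} u → Adj H (sub a b) u → u ≡ left a ⊎ u ≡ right b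
  sub-neighbour (inj₁ _) (inj₁ refl) = inj₁ refl
  sub-neighbour (inj₁ _) (inj₂ refl) = inj₂ refl

  sub-left-neighbour : ∀ {a a' b} → Adj H (sub a b) (left a') → a' ≡ a
  sub-left-neighbour (inj₁ eq) = ↑ˡ-injective n _ _ eq
  sub-left-neighbour (inj₂ eq) = ⊥-elim (↑ˡ≢↑ʳ _ _ eq)

  sub-right-neighbour : ∀ {a b b'} → Adj H (sub a b) (right b') → b' ≡ b
  sub-right-neighbour (inj₁ eq) = ⊥-elim (↑ˡ≢↑ʳ _ _ (sym eq))
  sub-right-neighbour (inj₂ eq) = ↑ʳ-injective m _ _ eq

  module PartColouring {k} (cL : Fin m → Fin k) (cR : Fin n → Fin k) (cS : Fin m → Fin n → Fin k) where

    colouring : Vertex → Fin k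
    colouring (inj₁ x) = [ cL , cR ] (splitAt m x)
    colouring (inj₂ e) = uncurry cS (endpoints e)

    colouring-left : ∀ a → colouring (left a) ≡ cL a
    colouring-left a rewrite splitAt-↑ˡ m a n = refl

    colouring-right : ∀ b → colouring (right b) ≡ cR b
    colouring-right b rewrite splitAt-↑ʳ m n b = refl

    colouring-sub : ∀ a b → colouring (sub a b) ≡ cS a b
    colouring-sub a b = cong (uncurry cS) (endpoints-edge a b)

    colourOf : ∀ {u} → VertexView u → Fin k
    colourOf (is-left a)  = cL a
    colourOf (is-right b) = cR b
    colourOf (is-sub a b) = cS a b

    colouring-view : ∀ {u} (v : VertexView u) → colouring u ≡ colourOf v
    colouring-view (is-left a)  = colouring-left a
    colouring-view (is-right b) = colouring-right b
    colouring-view (is-sub a b) = colouring-sub a b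

    module _ (cL-inj : Injective _≡_ _≡_ cL) (cR-inj : Injective _≡_ _≡_ cR)
             (cS≢cL : ∀ a b → cS a b ≢ cL a) (cS≢cR : ∀ a b → cS a b ≢ cR b) where

      private
        proper-view : ∀ {x y} (vx : VertexView x) (vy : VertexView y) → Adj H x y → colourOf vx ≢ colourOf vy
        proper-view (is-left a)  (is-left a')  adj eq = proj₁ adj (cong (_↑ˡ n) (cL-inj eq))
        proper-view (is-left a)  (is-right b)  adj    = ⊥-elim (left-right-nonadj a b adj)
        proper-view (is-left a)  (is-sub a' b) adj eq with sub-left-neighbour (Graph.sym H {left a} {sub a' b} adj)
        ... | refl = cS≢cL a b (sym eq)
        proper-view (is-right b) (is-left a)   adj    = ⊥-elim (right-left-nonadj b a adj)
        proper-view (is-right b) (is-right b') adj eq = proj₁ adj (cong (m ↑ʳ_) (cR-inj eq))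
        proper-view (is-right b) (is-sub a b') adj eq with sub-right-neighbour (Graph.sym H {right b} {sub a b'} adj)
        ... | refl = cS≢cR a b (sym eq)
        proper-view (is-sub a b) (is-left a')  adj eq with sub-left-neighbour adj
        ... | refl = cS≢cL a b eq
        proper-view (is-sub a b) (is-right b') adj eq with sub-right-neighbour adj
        ... | refl = cS≢cR a b eq

      colouring-proper : ∀ {x y} → Adj H x y → colouring x ≢ colouring y
      colouring-proper {x} {y} adj eq =
        proper-view vx vy adj (trans (sym (colouring-view vx)) (trans eq (colouring-view vy)))
        where
        vx = vertexView x
        vy = vertexView y

    dominates-by-parts : ∀ {v t} →
      (∀ a → cL a ≡ t → Adj H v (left a)) → (∀ b → cR b ≡ t → Adj H v (right b)) →
      (∀ a b → cS a b ≡ t → Adj H v (sub a b)) → Dominates H colouring v t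
    dominates-by-parts dL dR dS u eq with vertexView u
    ... | is-left a  = dL a (trans (sym (colouring-left a)) eq)
    ... | is-right b = dR b (trans (sym (colouring-right b)) eq)
    ... | is-sub a b = dS a b (trans (sym (colouring-sub a b)) eq)

  module _ {k} {col : Vertex → Fin k} (tdc : IsTDC H k col) where
    open IsTDC tdc

    left-colour-injective : Injective _≡_ _≡_ (col ∘ left)
    left-colour-injective = proper-injective-on-clique H col _≟_ left left-adj proper

    right-colour-injective : Injective _≡_ _≡_ (col ∘ right)
    right-colour-injective = proper-injective-on-clique H col _≟_ right right-adj proper

    sub-dominates-endpoint-class : ∀ a b →
      Dominates H col (sub a b) (col (left a)) ⊎ Dominates H col (sub a b) (col (right b))
    sub-dominates-endpoint-class a b with dominates-neighbour-class H col tdc (sub a b)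
    ... | u , adj , D with sub-neighbour u adj
    ... | inj₁ refl = inj₁ D
    ... | inj₂ refl = inj₂ D

    module Collision {a₀ b₀} (collision : col (left a₀) ≡ col (right b₀)) where

      collision-unique : ∀ {a b} → col (left a) ≡ col (right b) → a ≡ a₀ × b ≡ b₀
      collision-unique {a} {b} eq with sub-dominates-endpoint-class a b₀
      ... | inj₁ D = left-colour-injective (trans eq (trans (cong (col ∘ right) b≡b₀) (sym collision))) , b≡b₀
        where
        b≡b₀ = sub-right-neighbour (D (right b) (sym eq))
      ... | inj₂ D with sub-left-neighbour (D (left a₀) collision)
      ...   | refl = refl , right-colour-injective (trans (sym eq) collision)

      sub-colour-new-left : ∀ a → col (sub a₀ b₀) ≢ col (left a)
      sub-colour-new-left a eq with sub-dominates-endpoint-class a b₀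
      ... | inj₁ D = D (sub a₀ b₀) eq
      ... | inj₂ D with sub-left-neighbour (D (left a₀) collision)
      ...   | refl = proper (sub-adj-left b₀ refl) eq

      sub-colour-new-right : ∀ b → col (sub a₀ b₀) ≢ col (right b)
      sub-colour-new-right b eq with sub-dominates-endpoint-class a₀ b
      ... | inj₂ D = D (sub a₀ b₀) eq
      ... | inj₁ D with sub-right-neighbour (D (right b₀) (sym collision))
      ...   | refl = proper (sub-adj-right a₀ refl) eq

      -- right b₀ repeats the colour of left a₀, so the new colour of sub a₀ b₀ is counted instead.
      recolour-right : Fin n → Fin k
      recolour-right b with b ≟ b₀
      ... | yes _ = col (sub a₀ b₀)
      ... | no  _ = col (right b)

      recolour-right-injective : Injective _≡_ _≡_ recolour-right
      recolour-right-injective {b} {b'} eq with b ≟ b₀ | b' ≟ b₀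
      ... | yes refl | yes refl = refl
      ... | yes _    | no  _    = ⊥-elim (sub-colour-new-right b' eq)
      ... | no  _    | yes _    = ⊥-elim (sub-colour-new-right b (sym eq))
      ... | no  _    | no  _    = right-colour-injective eq

      left≢recolour-right : ∀ a b → col (left a) ≢ recolour-right b
      left≢recolour-right a b eq with b ≟ b₀
      ... | yes _    = sub-colour-new-left a (sym eq)
      ... | no b≢b₀ = b≢b₀ (proj₂ (collision-unique eq))

    m+n≤colours : m + n ≤ k
    m+n≤colours with any? (λ a → any? (λ b → col (left a) ≟ col (right b)))
    ... | yes (a₀ , b₀ , collision) =
      ⊎-injective⇒+≤ ([,]-injective left-colour-injective recolour-right-injective left≢recolour-right)
      where open Collision collision
    ... | no no-collision =
      ⊎-injective⇒+≤ ([,]-injective left-colour-injective right-colour-injective λ a b eq → no-collision (a , b , eq))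

  tdc-lower-bound : ∀ k → HasTDC H k → m + n ≤ k
  tdc-lower-bound k (col , tdc) = m+n≤colours tdc

module RotationColouring (m' n' : ℕ) where
  open CentralCompleteBipartite (2 + m') (2 + n')

  m = 2 + m'
  n = 2 + n'

  open PartColouring (_↑ˡ n) (m ↑ʳ_) (λ a _ → rotateDown a ↑ˡ n)

  tdc : IsTDC H (m + n) colouring
  tdc = record
    { proper    = colouring-proper (↑ˡ-injective n _ _) (↑ʳ-injective m _ _)
                    (λ a _ eq → rotateDown≢id a (↑ˡ-injective n _ _ eq)) (λ a b → ↑ˡ≢↑ʳ (rotateDown a) b)
    ; onto      = onto
    ; dominates = dominates
    }
    where
    onto : ∀ t → ∃[ v ] colouring v ≡ t
    onto t with splitAt m t in eq
    ... | inj₁ a = left a , trans (colouring-left a) (splitAt⁻¹-↑ˡ eq)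
    ... | inj₂ b = right b , trans (colouring-right b) (splitAt⁻¹-↑ʳ eq)

    dominates : ∀ v → ∃[ t ] Dominates H colouring v t
    dominates v with vertexView v
    ... | is-left a = rotateDown a ↑ˡ n , dominates-by-parts
      (λ a' eq → left-adj λ a≡a' → rotateDown≢id a (sym (trans a≡a' (↑ˡ-injective n _ _ eq))))
      (λ b eq → ⊥-elim (↑ˡ≢↑ʳ (rotateDown a) b (sym eq)))
      (λ a' b eq → left-adj-sub b (sym (rotateDown-injective (↑ˡ-injective n _ _ eq))))
    ... | is-right b = m ↑ʳ rotateDown b , dominates-by-parts
      (λ a eq → ⊥-elim (↑ˡ≢↑ʳ a (rotateDown b) eq))
      (λ b' eq → right-adj λ b≡b' → rotateDown≢id b (sym (trans b≡b' (↑ʳ-injective m _ _ eq))))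
      (λ a b' eq → ⊥-elim (↑ˡ≢↑ʳ (rotateDown a) (rotateDown b) eq))
    ... | is-sub a b = m ↑ʳ b , dominates-by-parts
      (λ a' eq → ⊥-elim (↑ˡ≢↑ʳ a' b eq))
      (λ b' eq → sub-adj-right a (↑ʳ-injective m _ _ eq))
      (λ a' b' eq → ⊥-elim (↑ˡ≢↑ʳ (rotateDown a') b eq))

  hasTDC : HasTDC H (m + n)
  hasTDC = colouring , tdc

module StarColouring (n' : ℕ) where
  open CentralCompleteBipartite 1 (suc n')

  colourRight : Fin (suc n') → Fin (suc (suc n'))
  colourRight zero    = zero
  colourRight (suc j) = suc (suc j)

  colourRight-injective : Injective _≡_ _≡_ colourRight
  colourRight-injective {zero}  {zero}  _  = refl
  colourRight-injective {suc i} {suc j} eq = cong suc (suc-injective (suc-injective eq))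

  colourRight≢1 : ∀ b → colourRight b ≢ suc zero
  colourRight≢1 zero    ()
  colourRight≢1 (suc _) ()

  open PartColouring (λ _ → zero) colourRight (λ _ _ → suc zero) public

  proper : ∀ {x y} → Adj H x y → colouring x ≢ colouring y
  proper = colouring-proper (λ { {zero} {zero} _ → refl }) colourRight-injective
             (λ _ _ ()) (λ _ b → colourRight≢1 b ∘ sym)

  onto : ∀ t → ∃[ v ] colouring v ≡ t
  onto zero          = left zero , colouring-left zero
  onto (suc zero)    = sub zero zero , colouring-sub zero zero
  onto (suc (suc j)) = right (suc j) , colouring-right (suc j)

  dominates-left : ∀ a → ∃[ t ] Dominates H colouring (left a) t
  dominates-left zero = suc zero , dominates-by-parts
    (λ _ ())
    (λ b eq → ⊥-elim (colourRight≢1 b eq))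
    (λ { zero b _ → left-adj-sub b refl })

  dominates-sub : ∀ a b → ∃[ t ] Dominates H colouring (sub a b) t
  dominates-sub zero b = colourRight b , dominates-by-parts
    (λ { zero _ → sub-adj-left b refl })
    (λ b' eq → sub-adj-right zero (colourRight-injective eq))
    (λ _ _ eq → colourRight≢1 b (sym eq))

  -- For n = 1 a right vertex dominates the subdivision class, for n ≥ 3 another right vertex.
  tdc : (∀ b → ∃[ t ] Dominates H colouring (right b) t) → IsTDC H (suc (suc n')) colouring
  tdc dominates-right = record { proper = proper ; onto = onto ; dominates = dominates }
    where
    dominates : ∀ v → ∃[ t ] Dominates H colouring v t
    dominates v with vertexView v
    ... | is-left a  = dominates-left a
    ... | is-right b = dominates-right b
    ... | is-sub a b = dominates-sub a b

another-nonzero : ∀ {k} (b : Fin (suc (suc (suc k)))) → ∃[ j ] suc j ≢ b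
another-nonzero zero          = zero , λ ()
another-nonzero (suc zero)    = suc zero , λ ()
another-nonzero (suc (suc _)) = zero , λ ()

star-dominates-right : ∀ n' → n' ≢ 1 → ∀ b →
  ∃[ t ] Dominates (central (K 1 (suc n'))) (StarColouring.colouring n') (CentralCompleteBipartite.right 1 (suc n') b) t
star-dominates-right 0 _ zero = suc zero , dominates-by-parts
  (λ _ ())
  (λ { zero () })
  (λ { zero zero _ → right-adj-sub zero refl })
  where open StarColouring 0
        open CentralCompleteBipartite 1 1
star-dominates-right 1 n'≢1 = ⊥-elim (n'≢1 refl)
star-dominates-right (suc (suc n'')) _ b with another-nonzero b
... | j , j≢b = suc (suc j) , dominates-by-parts
  (λ _ ())
  (λ b' eq → right-adj λ b≡b' → j≢b (sym (trans b≡b' (colourRight-injective eq))))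
  (λ _ _ ())
  where open StarColouring (suc (suc n''))
        open CentralCompleteBipartite 1 (suc (suc (suc n'')))

star-hasTDC : ∀ n' → n' ≢ 1 → HasTDC (central (K 1 (suc n'))) (suc (suc n'))
star-hasTDC n' n'≢1 = colouring , tdc (star-dominates-right n' n'≢1)
  where open StarColouring n'

Fin2-≢-≡ : ∀ {x y z : Fin 2} → x ≢ z → y ≢ z → x ≡ y
Fin2-≢-≡ {zero}     {zero}     _   _   = refl
Fin2-≢-≡ {suc zero} {suc zero} _   _   = refl
Fin2-≢-≡ {zero}     {suc zero} {zero}     x≢z _   = ⊥-elim (x≢z refl)
Fin2-≢-≡ {zero}     {suc zero} {suc zero} _   y≢z = ⊥-elim (y≢z refl)
Fin2-≢-≡ {suc zero} {zero}     {zero}     _   y≢z = ⊥-elim (y≢z refl)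
Fin2-≢-≡ {suc zero} {zero}     {suc zero} x≢z _   = ⊥-elim (x≢z refl)

module K₁₂ where
  open CentralCompleteBipartite 1 2

  module _ {k} {col : Vertex → Fin k} (tdc : IsTDC H k col) where
    open IsTDC tdc

    sub-colours-differ : ∀ {b b'} → col (left zero) ≡ col (right b) → b' ≢ b → col (sub zero b) ≢ col (sub zero b')
    sub-colours-differ {b} {b'} collision b'≢b eq with dominates-neighbour-class H col tdc (right b')
    ... | u , adj , D = impossible (vertexView u) adj D
      where
      impossible : ∀ {u} → VertexView u → Adj H (right b') u → Dominates H col (right b') (col u) → ⊥
      impossible (is-left a) adj _ = right-left-nonadj b' a adj
      impossible (is-right b'') adj D with Fin2-≢-≡ {b''} (λ b''≡b' → proj₁ adj (cong (1 ↑ʳ_) (sym b''≡b'))) (b'≢b ∘ sym)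
      ... | refl = right-left-nonadj b' zero (D (left zero) collision)
      impossible (is-sub zero b'') adj D with sub-right-neighbour (Graph.sym H {right b'} {sub zero b''} adj)
      ... | refl = b'≢b (sub-right-neighbour (Graph.sym H {right b'} {sub zero b} (D (sub zero b) eq)))

    4≤colours : 4 ≤ k
    4≤colours with any? (λ b → col (left zero) ≟ col (right b))
    ... | no no-collision with dominates (left zero)
    ...   | t , D = four-distinct⇒4≤
      (λ eq → no-collision (zero , eq))
      (λ eq → no-collision (suc zero , eq))
      (λ eq → Graph.irrefl H (D (left zero) eq))
      (proper (right-adj λ ()))
      (λ eq → left-right-nonadj zero zero (D (right zero) eq))
      (λ eq → left-right-nonadj zero (suc zero) (D (right (suc zero)) eq))
    4≤colours | yes (b , collision) = four-distinct⇒4≤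
      {w = col (left zero)} {col (right b')} {col (sub zero b)} {col (sub zero b')}
      (λ eq → b'≢b (right-colour-injective tdc (trans (sym eq) collision)))
      (sub-colour-new-left zero ∘ sym)
      (proper (sub-adj-left b' refl) ∘ sym)
      (sub-colour-new-right b' ∘ sym)
      (proper (sub-adj-right zero refl) ∘ sym)
      (sub-colours-differ collision b'≢b)
      where
      open Collision tdc collision
      b' = rotateDown b
      b'≢b = rotateDown≢id b

  tdc-lower-bound₄ : ∀ k → HasTDC H k → 4 ≤ k
  tdc-lower-bound₄ k (col , tdc) = 4≤colours tdc

  colourRight : Fin 2 → Fin 4
  colourRight b = suc (inject₁ b)

  colourRight-injective : Injective _≡_ _≡_ colourRight
  colourRight-injective = inject₁-injective ∘ suc-injective

  open PartColouring (λ _ → zero) colourRight (λ _ _ → fromℕ 3)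

  colourRight≢3 : ∀ b → colourRight b ≢ fromℕ 3
  colourRight≢3 b = fromℕ≢inject₁ ∘ sym ∘ suc-injective

  tdc₄ : IsTDC H 4 colouring
  tdc₄ = record
    { proper    = colouring-proper (λ { {zero} {zero} _ → refl }) colourRight-injective
                    (λ _ _ ()) (λ _ b → colourRight≢3 b ∘ sym)
    ; onto      = onto
    ; dominates = dominates
    }
    where
    onto : ∀ t → ∃[ v ] colouring v ≡ t
    onto zero                   = left zero , colouring-left zero
    onto (suc zero)             = right zero , colouring-right zero
    onto (suc (suc zero))       = right (suc zero) , colouring-right (suc zero)
    onto (suc (suc (suc zero))) = sub zero zero , colouring-sub zero zero

    dominates : ∀ v → ∃[ t ] Dominates H colouring v t
    dominates v with vertexView v
    ... | is-left zero = fromℕ 3 , dominates-by-parts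
      (λ _ ())
      (λ b eq → ⊥-elim (colourRight≢3 b eq))
      (λ { zero b _ → left-adj-sub b refl })
    ... | is-right b = colourRight (rotateDown b) , dominates-by-parts
      (λ _ ())
      (λ b' eq → right-adj λ b≡b' → rotateDown≢id b (sym (trans b≡b' (colourRight-injective eq))))
      (λ _ _ eq → ⊥-elim (colourRight≢3 (rotateDown b) (sym eq)))
    ... | is-sub zero b = colourRight b , dominates-by-parts
      (λ _ ())
      (λ b' eq → sub-adj-right zero (colourRight-injective eq))
      (λ _ _ eq → colourRight≢3 b (sym eq))

  tdcNumber : TDCNumber H 4
  tdcNumber = (colouring , tdc₄) , tdc-lower-bound₄

central-K-hasTDC : ∀ m n → 1 ≤ m → m ≤ n → ¬ ((m ≡ 1) × (n ≡ 2)) → HasTDC (central (K m n)) (m + n)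
central-K-hasTDC 0             _                   () _        _
central-K-hasTDC 1             0                   _  ()       _
central-K-hasTDC 1             1                   _  _        _   = star-hasTDC 0 λ ()
central-K-hasTDC 1             2                   _  _        ¬12 = ⊥-elim (¬12 (refl , refl))
central-K-hasTDC 1             (suc (suc (suc n))) _  _        _   = star-hasTDC (suc (suc n)) λ ()
central-K-hasTDC (suc (suc m)) (suc (suc n))       _  _        _   = RotationColouring.hasTDC m n
central-K-hasTDC (suc (suc _)) 0                   _  ()       _
central-K-hasTDC (suc (suc _)) 1                   _  (s≤s ()) _

proposition5p4 : ∀ (m n : ℕ) → 1 ≤ m → m ≤ n →
    (((m ≡ 1) × (n ≡ 2)) → TDCNumber (central (K m n)) 4) ×
    (¬ ((m ≡ 1) × (n ≡ 2)) → TDCNumber (central (K m n)) (m + n))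
proposition5p4 m n 1≤m m≤n =
    (λ { (refl , refl) → K₁₂.tdcNumber })
  , λ ¬12 → central-K-hasTDC m n 1≤m m≤n ¬12 , CentralCompleteBipartite.tdc-lower-bound m n
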